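{- Let $P$ be a $1$-phase-bounded protocol. Then: (i) If $C_1,C_1',C_2$ are star-configurations with $C_1\to C_1'$ and $C_1\preceq C_2$, then there exists a star-configuration $C_2'$ with $C_1'\preceq C_2'$ and $C_2\to^* C_2'$. (ii) If $C_1,C_1',C_2$ are b-configurations with $C_1\to C_1'$, $\mathrm{bprint}(C_1)=\mathrm{bprint}(C_2)$ and $C_1\preceq C_2$, then there exists a b-configuration $C_2'$ with $C_1'\preceq C_2'$, $\mathrm{bprint}(C_1')=\mathrm{bprint}(C_2')$ and $C_2\to^* C_2'$. (iii) If $C$ is a b-configuration with $C_{in}\to^* C$ for some initial configuration $C_{in}$, then for every $N\in\mathbb{N}$ there exist an initial configuration $C'_{in}$ and a b-configuration $C'=(\Gamma',L')$ such that $C'_{in}\to^* C'$, $\mathrm{bprint}(C)=\mathrm{bprint}(C')=(q,\Lambda)$ for some $(q,\Lambda)$, and $|\{v\in V(\Gamma')\setminus\{\epsilon\}: L'(v)=q'\}|\ge N$ for all $q'\in\Lambda$.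
   Context: A broadcast protocol is $P=(Q,\Sigma,q_{in},\Delta)$ with finite $Q$, finite $\Sigma$, $q_{in}\in Q$, $\Delta\subseteq Q\times(\{!!m\}\cup\{?m\}\cup\{\tau\})\times Q$ ($m\in\Sigma$; broadcast, reception, internal). $R(q)=\{m:\exists q',(q,?m,q')\in\Delta\}$. Topologies are finite undirected graphs without self-loops; configurations $(\Gamma,L)$ with $L:V(\Gamma)\to Q$, initial if all labels are $q_{in}$. $C=(\Gamma,L)\xrightarrow{v,\delta}C'=(\Gamma,L')$ for $\delta=(q,\alpha,q')$ if $L(v)=q$, $L'(v)=q'$ and either $\alpha=\tau$ and other labels unchanged, or $\alpha=!!m$, every neighbour $u$ of $v$ satisfies $(L(u),?m,L'(u))\in\Delta$ or ($m\notin R(L(u))$ and $L'(u)=L(u)$), and non-neighbours other than $v$ are unchanged; $\to$ is the union of these steps and $\to^*$ its reflexive transitive closure. $P$ is $1$-phase-bounded if $Q$ can be partitioned into $Q_0,Q_1^b,Q_1^r$ with $q_{in}\in Q_0$ such that every $(q,\alpha,q')\in\Delta$ satisfies one of: $\alpha=\tau$ and $q,q'$ in the same part; $q,q'\in Q_1^b$, $\alpha$ a broadcast; $q,q'\in Q_1^r$, $\alpha$ a reception; $q\in Q_0,q'\in Q_1^r$, $\alpha$ a reception; $q\in Q_0,q'\in Q_1^b$, $\alpha$ a broadcast; $q\in Q_1^b,q'\in Q_1^r$, $\alpha$ a reception. Let $Q^b=Q_0\cup Q_1^b$. A star topology has vertex set $\{\epsilon\}\cup\{1,\dots,n\}$ ($n\ge0$)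 with edges exactly between $\epsilon$ and each other vertex; a star-configuration is a configuration on a star topology. A b-configuration is a star-configuration $C=(\Gamma,L)$ with $L(\epsilon)\in Q^b$; its broadcast-print is $\mathrm{bprint}(C)=(L(\epsilon),\{L(v)\in Q^b:v\in V(\Gamma)\setminus\{\epsilon\}\})$. For star-configurations $C=(\Gamma,L)$, $C'=(\Gamma',L')$, $C\preceq C'$ iff $L(\epsilon)=L'(\epsilon)$ and for every $q\in Q^b$, $|\{v\in V(\Gamma)\setminus\{\epsilon\}:L(v)=q\}|\le|\{v\in V(\Gamma')\setminus\{\epsilon\}:L'(v)=q\}|$. -}

module Defs where

open import Data.Nat using (ℕ; zero; suc; _≤_)
open import Data.Fin using (Fin; zero; suc; _≟_)
open import Data.Fin.Subset using (Subset)
open import Data.Bool using (Bool; true; false; _∧_)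
open import Data.List using (List; length; filter; allFin)
open import Data.Bool.ListAction using (any)
open import Data.List.Membership.Propositional using (_∈_)
open import Data.Vec using (tabulate)
open import Data.Product using (Σ; ∃; _×_; _,_; proj₁; proj₂)
open import Data.Sum using (_⊎_)
open import Data.Empty using (⊥)
open import Relation.Nullary using (¬_; does)
open import Relation.Binary.PropositionalEquality using (_≡_; _≢_; refl)
open import Relation.Binary.Construct.Closure.ReflexiveTransitive using (Star)

data Act (nΣ : ℕ) : Set where
  bc  : Fin nΣ → Act nΣ
  rc  : Fin nΣ → Act nΣ
  tau : Act nΣ

record Protocol : Set where
  field
    nQ  : ℕ
    nΣ  : ℕ
    qin : Fin nQ
    Δ   : List (Fin nQ × Act nΣ × Fin nQ)

open Protocol public

R : (P : Protocol) → Fin (nQ P) → Fin (nΣ P) → Set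
R P q m = ∃ λ q' → (q , rc m , q') ∈ Δ P

record Graph : Set where
  field
    size   : ℕ
    adj    : Fin size → Fin size → Bool
    sym    : ∀ u v → adj u v ≡ adj v u
    irrefl : ∀ v → adj v v ≡ false

open Graph public

Config : Protocol → Set
Config P = Σ Graph (λ Γ → Fin (size Γ) → Fin (nQ P))

Initial : (P : Protocol) → Config P → Set
Initial P (Γ , L) = ∀ v → L v ≡ qin P

Effect : (P : Protocol) (Γ : Graph) (L L' : Fin (size Γ) → Fin (nQ P))
         (v : Fin (size Γ)) → Act (nΣ P) → Set
Effect P Γ L L' v tau = ∀ u → u ≢ v → L' u ≡ L u
Effect P Γ L L' v (bc m) =
  (∀ u → adj Γ v u ≡ true →
     ((L u , rc m , L' u) ∈ Δ P) ⊎ ((¬ R P (L u) m) × (L' u ≡ L u)))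
  × (∀ u → u ≢ v → adj Γ v u ≡ false → L' u ≡ L u)
Effect P Γ L L' v (rc m) = ⊥

data Step (P : Protocol) : Config P → Config P → Set where
  step : ∀ {Γ L L'} (v : Fin (size Γ)) (q : Fin (nQ P)) (a : Act (nΣ P)) (q' : Fin (nQ P)) →
         (q , a , q') ∈ Δ P → L v ≡ q → L' v ≡ q' → Effect P Γ L L' v a →
         Step P (Γ , L) (Γ , L')

Reach : (P : Protocol) → Config P → Config P → Set
Reach P = Star (Step P)

data Part : Set where
  P0 P1b P1r : Part

data Allowed (P : Protocol) (part : Fin (nQ P) → Part) :
     Fin (nQ P) → Act (nΣ P) → Fin (nQ P) → Set where
  τ-same  : ∀ {q q'} → part q ≡ part q' → Allowed P part q tau q'
  b-1b1b  : ∀ {q q' m} → part q ≡ P1b → part q' ≡ P1b → Allowed P part q (bc m) q'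
  r-1r1r  : ∀ {q q' m} → part q ≡ P1r → part q' ≡ P1r → Allowed P part q (rc m) q'
  r-01r   : ∀ {q q' m} → part q ≡ P0 → part q' ≡ P1r → Allowed P part q (rc m) q'
  b-01b   : ∀ {q q' m} → part q ≡ P0 → part q' ≡ P1b → Allowed P part q (bc m) q'
  r-1b1r  : ∀ {q q' m} → part q ≡ P1b → part q' ≡ P1r → Allowed P part q (rc m) q'

PhaseBounded1 : (P : Protocol) → (Fin (nQ P) → Part) → Set
PhaseBounded1 P part =
  (part (qin P) ≡ P0) × (∀ q a q' → (q , a , q') ∈ Δ P → Allowed P part q a q')

isB : Part → Bool
isB P0  = true
isB P1b = true
isB P1r = false

-- star topology on {ε} ∪ {1..n}: ε = zero, i = suc (i-1)
starAdj : (n : ℕ) → Fin (suc n) → Fin (suc n) → Bool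
starAdj n zero    zero    = false
starAdj n zero    (suc _) = true
starAdj n (suc _) zero    = true
starAdj n (suc _) (suc _) = false

starSym : (n : ℕ) → ∀ u v → starAdj n u v ≡ starAdj n v u
starSym n zero    zero    = refl
starSym n zero    (suc _) = refl
starSym n (suc _) zero    = refl
starSym n (suc _) (suc _) = refl

starIrr : (n : ℕ) → ∀ v → starAdj n v v ≡ false
starIrr n zero    = refl
starIrr n (suc _) = refl

star : ℕ → Graph
star n = record { size = suc n ; adj = starAdj n ; sym = starSym n ; irrefl = starIrr n }

-- star-configurations: number n of leaves and labelling of {ε,1..n}
StarConf : Protocol → Set
StarConf P = Σ ℕ (λ n → Fin (suc n) → Fin (nQ P))

toConf : (P : Protocol) → StarConf P → Config P
toConf P (n , L) = (star n , L)

centre : (P : Protocol) → StarConf P → Fin (nQ P)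
centre P (n , L) = L zero

IsBConf : (P : Protocol) → (Fin (nQ P) → Part) → StarConf P → Set
IsBConf P part C = isB (part (centre P C)) ≡ true

count : (P : Protocol) → StarConf P → Fin (nQ P) → ℕ
count P (n , L) q = length (filter (λ v → L (suc v) ≟ q) (allFin n))

bprint : (P : Protocol) → (Fin (nQ P) → Part) → StarConf P → Fin (nQ P) × Subset (nQ P)
bprint P part (n , L) =
  (L zero , tabulate (λ q → isB (part q) ∧ any (λ v → does (L (suc v) ≟ q)) (allFin n)))

Preceq : (P : Protocol) → (Fin (nQ P) → Part) → StarConf P → StarConf P → Set
Preceq P part C C' =
  (centre P C ≡ centre P C') × (∀ q → isB (part q) ≡ true → count P C q ≤ count P C' q)

{-# OPTIONS --safe #-}
-- In a 1-phase-bounded protocol every reception leads into Q₁ʳ, which is never left and from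
-- which nothing is broadcast. So a leaf in Q₁ʳ is invisible, and after a broadcast of m a leaf
-- is in a state q ∈ Qᵇ iff it was already in q and q cannot receive m: the Qᵇ-counts of a star
-- configuration evolve in a way that depends only on its centre. Hence C₂ replays each step of
-- C₁ (a leaf step by a leaf of C₂ in the same state), which keeps ≼.
-- In (ii) and (iii) the centre stays in Qᵇ throughout, so it ignores all leaf steps, and a move
-- q → q' of one leaf of C₁ can be replayed by K leaves of C₂, or by all its leaves in q when C₁
-- empties q. This preserves "each Qᵇ-count of C₂ is at least K times that of C₁ and is zero iff
-- that one is": K = 1 gives (ii), and K = N + 1, starting from K·n initial leaves, gives (iii).
module Submission where

open import Defs hiding (sym)
open import Data.Nat using (ℕ; zero; suc; _+_; _*_; _≤_; _<_; z≤n; s≤s; _<ᵇ_)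
open import Data.Nat.Properties
  using ( ≤-refl; ≤-reflexive; ≤-trans; ≤-pred; <⇒≤; m≤n+m; m≤m*n; m≤n*m
        ; +-assoc; +-comm; +-identityʳ; +-cancelˡ-≡; +-cancelˡ-≤; +-mono-≤; +-monoʳ-≤
        ; *-assoc; *-identityˡ; *-identityʳ; *-zeroʳ; *-suc; +-commutativeSemigroup )
open import Algebra.Properties.CommutativeSemigroup +-commutativeSemigroup using (x∙yz≈y∙xz)
open import Data.Bool using (Bool; true; false; if_then_else_; _∧_)
open import Data.Bool.Properties using (∧-conicalˡ; ∧-conicalʳ)
import Data.Bool as Bool
open import Data.Bool.ListAction using (any)
open import Data.Empty using (⊥; ⊥-elim)
open import Data.Fin using (Fin; zero; suc)
import Data.Fin as Fin
open import Data.Fin.Properties using (suc-injective)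
open import Data.Fin.Subset using (_∈_)
open import Data.List using (length; filter)
import Data.List as List
open import Data.List.Membership.Propositional using (find; lose) renaming (_∈_ to _∈ᴸ_)
open import Data.List.Relation.Unary.Any using (any?)
open import Data.Product using (∃; _×_; _,_; proj₁; proj₂)
open import Data.Sum using (_⊎_; inj₁; inj₂)
open import Data.Vec using (lookup; tabulate)
open import Data.Vec.Properties using (lookup∘tabulate; tabulate-cong; []=⇒lookup)
open import Data.Vec.Functional using (Vector; head; tail; _∷_; updateAt)
open import Data.Vec.Functional.Properties using (updateAt-updates; updateAt-minimal)
open import Function using (_∘_; const; id)
open import Relation.Binary.Construct.Closure.ReflexiveTransitive using (Star; ε; _◅_; _◅◅_)
import Relation.Binary.Construct.Closure.ReflexiveTransitive as Star
open import Relation.Binary.Definitions using (DecidableEquality)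
open import Relation.Binary.PropositionalEquality
open import Relation.Nullary using (¬_; Dec; yes; no; does)
open import Relation.Nullary.Decidable using (dec-true; dec-false; _×-dec_)

SamePositivity : ℕ → ℕ → Set
SamePositivity x y = (0 <ᵇ x) ≡ (0 <ᵇ y)

record Dominates (K x y : ℕ) : Set where
  constructor dominates
  field
    scaled       : K * x ≤ y
    samePositive : SamePositivity x y

positive-≤ : ∀ {m n} → suc m ≤ n → SamePositivity (suc m) n
positive-≤ (s≤s _) = refl

dominates-zero : ∀ K → Dominates K 0 0
dominates-zero K = dominates (≤-reflexive (*-zeroʳ K)) refl

dominates-scale : ∀ k x → Dominates (suc k) x (suc k * x)
dominates-scale k zero    = dominates ≤-refl (cong (0 <ᵇ_) (sym (*-zeroʳ k)))
dominates-scale k (suc x) = dominates ≤-refl refl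

dominates⇒≤ : ∀ {k x y} → Dominates (suc k) x y → x ≤ y
dominates⇒≤ {k} {x} (dominates le _) = ≤-trans (m≤n*m x (suc k)) le

≤⇒dominates₁ : ∀ {x y} → x ≤ y → SamePositivity x y → Dominates 1 x y
≤⇒dominates₁ {x} le same = dominates (subst (_≤ _) (sym (*-identityˡ x)) le) same

dominates-≥ : ∀ {k x y} → Dominates (suc k) x y → (0 <ᵇ y) ≡ true → suc k ≤ y
dominates-≥ {k} {suc x} (dominates le _) _ = ≤-trans (m≤m*n (suc k) (suc x)) le
dominates-≥ {k} {zero} (dominates _ same) pos with () ← trans same pos

-- When the last element leaves, everything in y must leave too, to keep the positivities equal.
dominates-source : ∀ {k x y} → Dominates (suc k) (suc x) y →
  ∃ λ j → suc k ≤ j × j ≤ y × (∀ {y'} → j + y' ≡ y → Dominates (suc k) x y')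
dominates-source {k} {zero} {y} (dominates le _) =
  y , subst (_≤ y) (*-identityʳ (suc k)) le , ≤-refl ,
  λ {y'} e → subst (Dominates (suc k) 0) (sym (+-cancelˡ-≡ y y' 0 (trans e (sym (+-identityʳ y)))))
                   (dominates-zero (suc k))
dominates-source {k} {suc x} {y} (dominates le _) =
  suc k , ≤-refl , ≤-trans (m≤m*n (suc k) (suc (suc x))) le ,
  λ {y'} e → let le' = +-cancelˡ-≤ (suc k) _ y' (subst₂ _≤_ (*-suc (suc k) (suc x)) (sym e) le)
             in dominates le' (positive-≤ le')

dominates-target : ∀ {k j x y} → suc k ≤ j → Dominates (suc k) x y → Dominates (suc k) (suc x) (j + y)
dominates-target {k} {suc j} {x} {y} k<j (dominates le _) =
  dominates (subst (_≤ suc j + y) (sym (*-suc (suc k) x)) (+-mono-≤ k<j le)) refl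

module Counting {A : Set} (_≟_ : DecidableEquality A) where

  δ : A → A → ℕ
  δ x y = if does (x ≟ y) then 1 else 0

  δ-refl : ∀ x → δ x x ≡ 1
  δ-refl x = cong (if_then 1 else 0) (dec-true (x ≟ x) refl)

  δ-≢ : ∀ {x y} → x ≢ y → δ x y ≡ 0
  δ-≢ {x} {y} x≢y = cong (if_then 1 else 0) (dec-false (x ≟ y) x≢y)

  occ : ∀ {n} → Vector A n → A → ℕ
  occ {zero}  g p = 0
  occ {suc n} g p = δ (head g) p + occ (tail g) p

  occ-witness : ∀ {n} {g : Vector A n} {p} → 0 < occ g p → ∃ λ v → g v ≡ p
  occ-witness {suc n} {g} {p} pos with head g ≟ p
  ... | yes e = zero , e
  ... | no _ with occ-witness pos
  ...   | v , e = suc v , e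

  occ-positive : ∀ {n} {g : Vector A n} {p} v → g v ≡ p → 0 < occ g p
  occ-positive {suc n} {g} {p} zero e rewrite e | δ-refl p = s≤s z≤n
  occ-positive {suc n} {g} {p} (suc v) e = ≤-trans (occ-positive v e) (m≤n+m _ (δ (head g) p))

  occ-≗ : ∀ {n} {g h : Vector A n} {p} → (∀ v → g v ≡ h v) → occ g p ≡ occ h p
  occ-≗ {zero}  eq = refl
  occ-≗ {suc n} {p = p} eq = cong₂ _+_ (cong (λ x → δ x p) (eq zero)) (occ-≗ (eq ∘ suc))

  occ-cong : ∀ {n} {g h : Vector A n} {p} →
    (∀ v → g v ≡ p → h v ≡ p) → (∀ v → h v ≡ p → g v ≡ p) → occ g p ≡ occ h p
  occ-cong {zero}  to from = refl
  occ-cong {suc n} {g} {h} {p} to from =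
    cong₂ _+_ (δ-cong (to zero) (from zero)) (occ-cong (to ∘ suc) (from ∘ suc))
    where
    δ-cong : ∀ {x y} → (x ≡ p → y ≡ p) → (y ≡ p → x ≡ p) → δ x p ≡ δ y p
    δ-cong {x} {y} x→y y→x with x ≟ p | y ≟ p
    ... | yes _   | yes _   = refl
    ... | no _    | no _    = refl
    ... | yes x≡p | no y≢p  = ⊥-elim (y≢p (x→y x≡p))
    ... | no x≢p  | yes y≡p = ⊥-elim (x≢p (y→x y≡p))

  occ-absent : ∀ {n} {g : Vector A n} {p} → (∀ v → g v ≢ p) → occ g p ≡ 0
  occ-absent {zero}  absent = refl
  occ-absent {suc n} absent = cong₂ _+_ (δ-≢ (absent zero)) (occ-absent (absent ∘ suc))

  occ-const : ∀ n c p → occ {n} (const c) p ≡ n * δ c p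
  occ-const zero    c p = refl
  occ-const (suc n) c p = cong (δ c p +_) (occ-const n c p)

  record OneMoved (q q' : A) (f f' : A → ℕ) : Set where
    constructor one-moved
    field balance : ∀ p → δ q p + f' p ≡ δ q' p + f p

  open OneMoved

  occ-update : ∀ {n} {g g' : Vector A n} w → (∀ v → v ≢ w → g' v ≡ g v) →
    OneMoved (g w) (g' w) (occ g) (occ g')
  occ-update {suc n} {g} {g'} zero frame = one-moved λ p → begin
    δ (g zero) p + (δ (g' zero) p + occ (tail g') p)
      ≡⟨ x∙yz≈y∙xz (δ (g zero) p) (δ (g' zero) p) _ ⟩
    δ (g' zero) p + (δ (g zero) p + occ (tail g') p)
      ≡⟨ cong (λ k → δ (g' zero) p + (δ (g zero) p + k)) (occ-≗ (λ v → frame (suc v) λ ())) ⟩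
    δ (g' zero) p + (δ (g zero) p + occ (tail g) p)
      ∎
    where open ≡-Reasoning
  occ-update {suc n} {g} {g'} (suc w) frame = one-moved λ p → begin
    δ (g (suc w)) p + (δ (g' zero) p + occ (tail g') p)
      ≡⟨ x∙yz≈y∙xz (δ (g (suc w)) p) (δ (g' zero) p) _ ⟩
    δ (g' zero) p + (δ (g (suc w)) p + occ (tail g') p)
      ≡⟨ cong (δ (g' zero) p +_) (balance (occ-update w frame-tail) p) ⟩
    δ (g' zero) p + (δ (g' (suc w)) p + occ (tail g) p)
      ≡⟨ x∙yz≈y∙xz (δ (g' zero) p) (δ (g' (suc w)) p) _ ⟩
    δ (g' (suc w)) p + (δ (g' zero) p + occ (tail g) p)
      ≡⟨ cong (λ x → δ (g' (suc w)) p + (δ x p + occ (tail g) p)) (frame zero λ ()) ⟩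
    δ (g' (suc w)) p + (δ (g zero) p + occ (tail g) p)
      ∎
    where
    open ≡-Reasoning
    frame-tail : ∀ v → v ≢ w → g' (suc v) ≡ g (suc v)
    frame-tail v v≢w = frame (suc v) (v≢w ∘ suc-injective)

  moved-in-place : ∀ {q f f'} → OneMoved q q f f' → ∀ p → f' p ≡ f p
  moved-in-place {q} moved p = +-cancelˡ-≡ (δ q p) _ _ (balance moved p)

  moved-elsewhere : ∀ {q q' f f' p} → q ≢ p → q' ≢ p → OneMoved q q' f f' → f' p ≡ f p
  moved-elsewhere {q} {q'} {f} {f'} {p} q≢p q'≢p moved =
    subst₂ (λ a b → a + f' p ≡ b + f p) (δ-≢ q≢p) (δ-≢ q'≢p) (balance moved p)

  moved-≤ : ∀ {q q' f₁ f₁' f₂ f₂'} → OneMoved q q' f₁ f₁' → OneMoved q q' f₂ f₂' →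
    ∀ p → f₁ p ≤ f₂ p → f₁' p ≤ f₂' p
  moved-≤ {q} {q'} moved₁ moved₂ p le =
    +-cancelˡ-≤ (δ q p) _ _ (subst₂ _≤_ (sym (balance moved₁ p)) (sym (balance moved₂ p)) (+-monoʳ-≤ (δ q' p) le))

  record Transfer (j : ℕ) (q q' : A) (f f' : A → ℕ) : Set where
    field
      source : j + f' q ≡ f q
      target : f' q' ≡ j + f q'
      others : ∀ p → p ≢ q → p ≢ q' → f' p ≡ f p

  open Transfer

  transfer-refl : ∀ {q q' f} → Transfer 0 q q' f f
  transfer-refl = record { source = refl ; target = refl ; others = λ _ _ _ → refl }

  transfer-one : ∀ {q q' f f'} → q ≢ q' → OneMoved q q' f f' → Transfer 1 q q' f f'
  transfer-one {q} {q'} {f} {f'} q≢q' moved = record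
    { source = subst₂ (λ a b → a + f' q ≡ b + f q) (δ-refl q) (δ-≢ (q≢q' ∘ sym)) (balance moved q)
    ; target = subst₂ (λ a b → a + f' q' ≡ b + f q') (δ-≢ q≢q') (δ-refl q') (balance moved q')
    ; others = λ p p≢q p≢q' → moved-elsewhere (p≢q ∘ sym) (p≢q' ∘ sym) moved
    }

  transfer-trans : ∀ {i j q q' f f' f''} →
    Transfer i q q' f f' → Transfer j q q' f' f'' → Transfer (i + j) q q' f f''
  transfer-trans {i} {j} {q} {q'} {f} {f'} {f''} t₁ t₂ = record
    { source = trans (+-assoc i j _) (trans (cong (i +_) (source t₂)) (source t₁))
    ; target = trans (target t₂) (trans (cong (j +_) (target t₁))
                 (trans (sym (+-assoc j i _)) (cong (_+ f q') (+-comm j i))))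
    ; others = λ p p≢q p≢q' → trans (others t₂ p p≢q p≢q') (others t₁ p p≢q p≢q')
    }

  transfer-dominates : ∀ {k j q q' f₁ f₁' f₂ f₂'} → suc k ≤ j →
    (∀ {y'} → j + y' ≡ f₂ q → Dominates (suc k) (f₁' q) y') →
    Transfer 1 q q' f₁ f₁' → Transfer j q q' f₂ f₂' →
    ∀ p → Dominates (suc k) (f₁ p) (f₂ p) → Dominates (suc k) (f₁' p) (f₂' p)
  transfer-dominates {k} {q = q} {q'} k<j dominated-at-q t₁ t₂ p d with p ≟ q | p ≟ q'
  ... | yes refl | _        = dominated-at-q (source t₂)
  ... | no _     | yes refl =
    subst₂ (Dominates (suc k)) (sym (target t₁)) (sym (target t₂)) (dominates-target k<j d)
  ... | no p≢q   | no p≢q'  =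
    subst₂ (Dominates (suc k)) (sym (others t₁ p p≢q p≢q')) (sym (others t₂ p p≢q p≢q')) d

  occ-filter : ∀ {m n} (g : Vector A n) (h : Fin m → Fin n) p →
    length (filter (λ v → g v ≟ p) (List.tabulate h)) ≡ occ (g ∘ h) p
  occ-filter {zero}  g h p = refl
  occ-filter {suc m} g h p with g (h zero) ≟ p
  ... | yes _ = cong suc (occ-filter g (h ∘ suc) p)
  ... | no _  = occ-filter g (h ∘ suc) p

  occ-any : ∀ {m n} (g : Vector A n) (h : Fin m → Fin n) p →
    any (λ v → does (g v ≟ p)) (List.tabulate h) ≡ (0 <ᵇ occ (g ∘ h) p)
  occ-any {zero}  g h p = refl
  occ-any {suc m} g h p with g (h zero) ≟ p
  ... | yes _ = refl
  ... | no _  = occ-any g (h ∘ suc) p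

module OnePhaseBounded (P : Protocol) (part : Fin (nQ P) → Part) (pb : PhaseBounded1 P part) where

  Q : Set
  Q = Fin (nQ P)

  open Counting (Fin._≟_ {nQ P})

  _—[_]→_ : Q → Act (nΣ P) → Q → Set
  p —[ a ]→ p' = (p , a , p') ∈ᴸ Δ P

  Qᵇ : Q → Set
  Qᵇ q = isB (part q) ≡ true

  Qᵇ? : ∀ q → Dec (Qᵇ q)
  Qᵇ? q = isB (part q) Bool.≟ true

  Q₁ʳ-∉-Qᵇ : ∀ {q} → part q ≡ P1r → ¬ Qᵇ q
  Q₁ʳ-∉-Qᵇ e b with () ← trans (sym (cong isB e)) b

  reception-leaves-Qᵇ : ∀ {p m p'} → p —[ rc m ]→ p' → ¬ Qᵇ p'
  reception-leaves-Qᵇ tr with proj₂ pb _ _ _ tr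
  ... | r-1r1r _ e = Q₁ʳ-∉-Qᵇ e
  ... | r-01r  _ e = Q₁ʳ-∉-Qᵇ e
  ... | r-1b1r _ e = Q₁ʳ-∉-Qᵇ e

  broadcast-from-Qᵇ : ∀ {p m p'} → p —[ bc m ]→ p' → Qᵇ p
  broadcast-from-Qᵇ tr with proj₂ pb _ _ _ tr
  ... | b-1b1b e _ = cong isB e
  ... | b-01b  e _ = cong isB e

  Qᵇ-backward : ∀ {p a p'} → p —[ a ]→ p' → Qᵇ p' → Qᵇ p
  Qᵇ-backward {a = tau} tr b with proj₂ pb _ _ _ tr
  ... | τ-same e = trans (cong isB e) b
  Qᵇ-backward {a = bc m} tr b = broadcast-from-Qᵇ tr
  Qᵇ-backward {a = rc m} tr b = ⊥-elim (reception-leaves-Qᵇ tr b)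

  ReceptionOf : Q → Fin (nΣ P) → Q × Act (nΣ P) × Q → Set
  ReceptionOf p m (p₀ , rc m₀ , _) = p₀ ≡ p × m₀ ≡ m
  ReceptionOf p m _                = ⊥

  reception? : ∀ p m t → Dec (ReceptionOf p m t)
  reception? p m (p₀ , rc m₀ , _) = (p₀ Fin.≟ p) ×-dec (m₀ Fin.≟ m)
  reception? p m (_  , bc _  , _) = no λ ()
  reception? p m (_  , tau   , _) = no λ ()

  R? : ∀ p m → Dec (R P p m)
  R? p m with any? (reception? p m) (Δ P)
  ... | no none = no λ (p' , tr) → none (lose tr (refl , refl))
  ... | yes found with find found
  ...   | (_ , rc _ , p') , tr , refl , refl = yes (p' , tr)

  Receives : Fin (nΣ P) → Q → Q → Set
  Receives m p p' = p —[ rc m ]→ p' ⊎ (¬ R P p m × p' ≡ p)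

  reaction : ∀ m p → ∃ (Receives m p)
  reaction m p with R? p m
  ... | yes (p' , tr) = p' , inj₁ tr
  ... | no deaf       = p , inj₂ (deaf , refl)

  receives-into-Qᵇ : ∀ {m p p'} → Receives m p p' → Qᵇ p' → p' ≡ p × ¬ R P p m
  receives-into-Qᵇ (inj₁ tr)          b = ⊥-elim (reception-leaves-Qᵇ tr b)
  receives-into-Qᵇ (inj₂ (deaf , e)) b = e , deaf

  receives-deaf : ∀ {m p p'} → ¬ R P p m → Receives m p p' → p' ≡ p
  receives-deaf deaf (inj₁ tr)     = ⊥-elim (deaf (_ , tr))
  receives-deaf deaf (inj₂ (_ , e)) = e

  -- Hears a c d: a step of a leaf with action a takes the centre from c to d.
  Hears : Act (nΣ P) → Q → Q → Set
  Hears tau    c d = d ≡ c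
  Hears (bc m) c d = Receives m c d
  Hears (rc m) c d = ⊥

  hears-into-Qᵇ : ∀ {a c d} → Hears a c d → Qᵇ d → d ≡ c
  hears-into-Qᵇ {tau}  h b = h
  hears-into-Qᵇ {bc m} h b = proj₁ (receives-into-Qᵇ h b)

  hears-from-outside-Qᵇ : ∀ {q a q' c d} → ¬ Qᵇ q → q —[ a ]→ q' → Hears a c d → d ≡ c
  hears-from-outside-Qᵇ {a = tau}  _   _  h = h
  hears-from-outside-Qᵇ {a = bc m} q∉ᵇ tr _ = ⊥-elim (q∉ᵇ (broadcast-from-Qᵇ tr))

  record LeafMove (n : ℕ) (L L' : Vector Q (suc n)) : Set where
    constructor leaf-move
    field
      mover      : Fin n
      action     : Act (nΣ P)
      transition : L (suc mover) —[ action ]→ L' (suc mover)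
      heard      : Hears action (L zero) (L' zero)
      frame      : ∀ v → v ≢ mover → L' (suc v) ≡ L (suc v)

    before after : Q
    before = L (suc mover)
    after  = L' (suc mover)

    moved : OneMoved before after (occ (tail L)) (occ (tail L'))
    moved = occ-update mover frame

  open LeafMove using (before; after; moved)

  data StarStep (n : ℕ) (L L' : Vector Q (suc n)) : Set where
    centre-τ  : L zero —[ tau ]→ L' zero → (∀ v → L' (suc v) ≡ L (suc v)) → StarStep n L L'
    centre-bc : ∀ m → L zero —[ bc m ]→ L' zero →
                (∀ v → Receives m (L (suc v)) (L' (suc v))) → StarStep n L L'
    leaf      : LeafMove n L L' → StarStep n L L'

  StarRun : (n : ℕ) → Vector Q (suc n) → Vector Q (suc n) → Set
  StarRun n = Star (StarStep n)

  starStep : ∀ {n L L'} → Step P (star n , L) (star n , L') → StarStep n L L'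
  starStep (step zero    _ tau    _ tr refl refl frame)            = centre-τ tr (λ v → frame (suc v) λ ())
  starStep (step zero    _ (bc m) _ tr refl refl (receives , _))   = centre-bc m tr (λ v → receives (suc v) refl)
  starStep (step (suc w) _ tau    _ tr refl refl frame)            =
    leaf (leaf-move w tau tr (frame zero λ ()) (λ v v≢w → frame (suc v) (v≢w ∘ suc-injective)))
  starStep (step (suc w) _ (bc m) _ tr refl refl (receives , frame)) =
    leaf (leaf-move w (bc m) tr (receives zero refl) (λ v v≢w → frame (suc v) (v≢w ∘ suc-injective) refl))

  fromStarStep : ∀ {n L L'} → StarStep n L L' → Step P (star n , L) (star n , L')
  fromStarStep {n} {L} {L'} (centre-τ tr frame) = step zero _ tau _ tr refl refl frame′
    where
    frame′ : ∀ u → u ≢ zero → L' u ≡ L u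
    frame′ zero    u≢0 = ⊥-elim (u≢0 refl)
    frame′ (suc v) _   = frame v
  fromStarStep {n} {L} {L'} (centre-bc m tr receives) =
    step zero _ (bc m) _ tr refl refl (receives′ , frame′)
    where
    receives′ : ∀ u → starAdj n zero u ≡ true → Receives m (L u) (L' u)
    receives′ (suc v) _ = receives v
    frame′ : ∀ u → u ≢ zero → starAdj n zero u ≡ false → L' u ≡ L u
    frame′ zero u≢0 _ = ⊥-elim (u≢0 refl)
  fromStarStep {n} {L} {L'} (leaf (leaf-move w tau tr h frame)) = step (suc w) _ tau _ tr refl refl frame′
    where
    frame′ : ∀ u → u ≢ suc w → L' u ≡ L u
    frame′ zero    _     = h
    frame′ (suc v) v≢w   = frame v (v≢w ∘ cong suc)
  fromStarStep {n} {L} {L'} (leaf (leaf-move w (bc m) tr h frame)) =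
    step (suc w) _ (bc m) _ tr refl refl (receives′ , frame′)
    where
    receives′ : ∀ u → starAdj n (suc w) u ≡ true → Receives m (L u) (L' u)
    receives′ zero _ = h
    frame′ : ∀ u → u ≢ suc w → starAdj n (suc w) u ≡ false → L' u ≡ L u
    frame′ (suc v) v≢w _ = frame v (v≢w ∘ cong suc)

  starRun : ∀ {n L L'} → Reach P (star n , L) (star n , L') → StarRun n L L'
  starRun ε = ε
  starRun (s@(step _ _ _ _ _ _ _ _) ◅ run) = starStep s ◅ starRun run

  fromStarRun : ∀ {n L L'} → StarRun n L L' → Reach P (star n , L) (star n , L')
  fromStarRun {n} = Star.gmap (star n ,_) fromStarStep

  private variable
    ρ : ℕ → ℕ → Set
    k n₁ n₂ : ℕ
    L₁ L₁' : Vector Q (suc n₁)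
    L₂ : Vector Q (suc n₂)

  leafCount : StarConf P → Q → ℕ
  leafCount (_ , L) = occ (tail L)

  record Related (ρ : ℕ → ℕ → Set) (C₁ C₂ : StarConf P) : Set where
    constructor related
    field
      centres : centre P C₁ ≡ centre P C₂
      counts  : ∀ q → Qᵇ q → ρ (leafCount C₁ q) (leafCount C₂ q)

  open Related

  CatchesUp : (ℕ → ℕ → Set) → StarConf P → StarConf P → Set
  CatchesUp ρ (n₂ , L₂) C₁ = ∃ λ L₂' → StarRun n₂ L₂ L₂' × Related ρ C₁ (n₂ , L₂')

  _≈ᵇ_ : ∀ {n} → Vector Q (suc n) → Vector Q (suc n) → Set
  L ≈ᵇ L' = ∀ q → Qᵇ q → occ (tail L) q ≡ occ (tail L') q

  Related-cong : ∀ {L₂'} → L₁' zero ≡ L₂' zero → L₁ ≈ᵇ L₁' → L₂ ≈ᵇ L₂' →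
    Related ρ (n₁ , L₁) (n₂ , L₂) → Related ρ (n₁ , L₁') (n₂ , L₂')
  Related-cong {ρ = ρ} centres′ same₁ same₂ r =
    related centres′ λ q b → subst₂ ρ (same₁ q b) (same₂ q b) (counts r q b)

  Related-map : ∀ {σ : ℕ → ℕ → Set} {C₁ C₂} → (∀ {x y} → ρ x y → σ x y) → Related ρ C₁ C₂ → Related σ C₁ C₂
  Related-map f r = related (centres r) λ q b → f (counts r q b)

  Related-zipWith : ∀ {σ τ : ℕ → ℕ → Set} {C₁ C₂} → (∀ {x y} → ρ x y → σ x y → τ x y) →
    Related ρ C₁ C₂ → Related σ C₁ C₂ → Related τ C₁ C₂
  Related-zipWith f r r′ = related (centres r) λ q b → f (counts r q b) (counts r′ q b)

  catch-up-centre-τ : L₁ zero —[ tau ]→ L₁' zero → (∀ v → L₁' (suc v) ≡ L₁ (suc v)) →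
    Related ρ (n₁ , L₁) (n₂ , L₂) → CatchesUp ρ (n₂ , L₂) (n₁ , L₁')
  catch-up-centre-τ {L₁' = L₁'} {L₂ = L₂} tr frame r =
    L₁' zero ∷ tail L₂ , centre-τ (subst (_—[ tau ]→ L₁' zero) (centres r) tr) (λ _ → refl) ◅ ε ,
    Related-cong refl (λ q _ → sym (occ-≗ frame)) (λ _ _ → refl) r

  occ-after-broadcast-receiving : ∀ {n m q} {g g' : Vector Q n} → (∀ v → Receives m (g v) (g' v)) →
    Qᵇ q → R P q m → occ g' q ≡ 0
  occ-after-broadcast-receiving {m = m} receives b r = occ-absent λ v e →
    let g'v≡gv , deaf = receives-into-Qᵇ (receives v) (subst Qᵇ (sym e) b)
    in deaf (subst (λ p → R P p m) (trans (sym e) g'v≡gv) r)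

  occ-after-broadcast-deaf : ∀ {n m q} {g g' : Vector Q n} → (∀ v → Receives m (g v) (g' v)) →
    Qᵇ q → ¬ R P q m → occ g' q ≡ occ g q
  occ-after-broadcast-deaf {m = m} receives b deaf = occ-cong
    (λ v e → trans (sym (proj₁ (receives-into-Qᵇ (receives v) (subst Qᵇ (sym e) b)))) e)
    (λ v e → trans (receives-deaf (subst (λ p → ¬ R P p m) (sym e) deaf) (receives v)) e)

  catch-up-centre-bc : ρ 0 0 → ∀ m → L₁ zero —[ bc m ]→ L₁' zero →
    (∀ v → Receives m (L₁ (suc v)) (L₁' (suc v))) →
    Related ρ (n₁ , L₁) (n₂ , L₂) → CatchesUp ρ (n₂ , L₂) (n₁ , L₁')
  catch-up-centre-bc {ρ = ρ} {L₁ = L₁} {L₁' = L₁'} {L₂ = L₂} ρ00 m tr receives₁ r =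
    L₁' zero ∷ leaves₂' , centre-bc m (subst (_—[ bc m ]→ L₁' zero) (centres r) tr) receives₂ ◅ ε ,
    related refl counts'
    where
    leaves₂' : Vector Q _
    leaves₂' v = proj₁ (reaction m (L₂ (suc v)))
    receives₂ : ∀ v → Receives m (L₂ (suc v)) (leaves₂' v)
    receives₂ v = proj₂ (reaction m (L₂ (suc v)))
    counts' : ∀ q → Qᵇ q → ρ (occ (tail L₁') q) (occ leaves₂' q)
    counts' q b with R? q m
    ... | yes receiving = subst₂ ρ (sym (occ-after-broadcast-receiving receives₁ b receiving))
                                   (sym (occ-after-broadcast-receiving receives₂ b receiving)) ρ00
    ... | no deaf       = subst₂ ρ (sym (occ-after-broadcast-deaf receives₁ b deaf))
                                   (sym (occ-after-broadcast-deaf receives₂ b deaf)) (counts r q b)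

  -- A leaf outside Qᵇ stays outside Qᵇ and cannot broadcast.
  silent-leaf : (s : LeafMove n₁ L₁ L₁') → ¬ Qᵇ (before s) →
    Related ρ (n₁ , L₁) (n₂ , L₂) → Related ρ (n₁ , L₁') (n₂ , L₂)
  silent-leaf {L₁ = L₁} {L₁' = L₁'} s@(leaf-move _ _ tr h _) q∉ᵇ r =
    Related-cong (trans (hears-from-outside-Qᵇ q∉ᵇ tr h) (centres r)) same (λ _ _ → refl) r
    where
    same : L₁ ≈ᵇ L₁'
    same q b = sym (moved-elsewhere (λ e → q∉ᵇ (subst Qᵇ (sym e) b))
                                    (λ e → q∉ᵇ (Qᵇ-backward tr (subst Qᵇ (sym e) b)))
                                    (moved s))

  stationary-leaf : (s : LeafMove n₁ L₁ L₁') → Qᵇ (L₁' zero) → before s ≡ after s →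
    Related ρ (n₁ , L₁) (n₂ , L₂) → Related ρ (n₁ , L₁') (n₂ , L₂)
  stationary-leaf s@(leaf-move _ _ _ h _) centre-b stays r =
    Related-cong (trans (hears-into-Qᵇ h centre-b) (centres r))
                 (λ p _ → sym (moved-in-place (subst (λ y → OneMoved _ y _ _) (sym stays) (moved s)) p))
                 (λ _ _ → refl) r

  move-leaf : ∀ {n} {L : Vector Q (suc n)} {q a q' d} w → L (suc w) ≡ q → q —[ a ]→ q' →
    Hears a (L zero) d → ∃ λ L' → StarStep n L L' × L' zero ≡ d × OneMoved q q' (occ (tail L)) (occ (tail L'))
  move-leaf {L = L} {a = a} {q'} {d} w refl tr h =
    d ∷ leaves' , leaf (leaf-move w a (subst (L (suc w) —[ a ]→_) (sym moved-here) tr) h frame) , refl ,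
    subst (λ y → OneMoved (L (suc w)) y (occ (tail L)) (occ leaves')) moved-here (occ-update w frame)
    where
    leaves' : Vector Q _
    leaves' = updateAt (tail L) w (const q')
    moved-here : leaves' w ≡ q'
    moved-here = updateAt-updates w (tail L)
    frame : ∀ v → v ≢ w → leaves' v ≡ L (suc v)
    frame v v≢w = updateAt-minimal v w (tail L) v≢w

  catch-up-leaf-≤ : (s : LeafMove n₁ L₁ L₁') → Qᵇ (before s) →
    Related _≤_ (n₁ , L₁) (n₂ , L₂) → CatchesUp _≤_ (n₂ , L₂) (n₁ , L₁')
  catch-up-leaf-≤ {L₁' = L₁'} s@(leaf-move w a tr h _) b r =
    let v , at-q                 = occ-witness (≤-trans (occ-positive w refl) (counts r _ b))
        L₂' , step₂ , centre₂ , moved₂ = move-leaf v at-q tr (subst (λ c → Hears a c (L₁' zero)) (centres r) h)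
    in L₂' , step₂ ◅ ε , related (sym centre₂) λ p b′ → moved-≤ (moved s) moved₂ p (counts r p b′)

  transfer-leaves : ∀ {n} {L : Vector Q (suc n)} {q a q'} → q —[ a ]→ q' → Hears a (L zero) (L zero) →
    q ≢ q' → ∀ j → j ≤ occ (tail L) q →
    ∃ λ L' → StarRun n L L' × L' zero ≡ L zero × Transfer j q q' (occ (tail L)) (occ (tail L'))
  transfer-leaves tr quiet q≢q' zero _ = _ , ε , refl , transfer-refl
  transfer-leaves {a = a} tr quiet q≢q' (suc j) j<count =
    let w , at-q                    = occ-witness (≤-trans (s≤s z≤n) j<count)
        L₁ , step₁ , centre₁ , moved₁ = move-leaf w at-q tr quiet
        t₁                          = transfer-one q≢q' moved₁
        L' , run , centre' , t      = transfer-leaves tr (subst (λ c → Hears a c c) (sym centre₁) quiet) q≢q' j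
                                        (≤-pred (subst (suc j ≤_) (sym (Transfer.source t₁)) j<count))
    in L' , step₁ ◅ run , trans centre' centre₁ , transfer-trans t₁ t

  -- The centre ends in Qᵇ, so it ignores the leaf; hence the move can be replayed by several leaves.
  catch-up-leaf-dominates : (s : LeafMove n₁ L₁ L₁') → Qᵇ (L₁' zero) → Qᵇ (before s) → before s ≢ after s →
    Related (Dominates (suc k)) (n₁ , L₁) (n₂ , L₂) → CatchesUp (Dominates (suc k)) (n₂ , L₂) (n₁ , L₁')
  catch-up-leaf-dominates {L₁ = L₁} {L₁' = L₁'} {k = k} {L₂ = L₂}
                          s@(leaf-move _ a tr h _) centre-b b q≢q' r =
    let j , k<j , j≤count , dominated-at-q = dominates-source dominated-before
        L₂' , run , centre₂ , t₂ = transfer-leaves tr quiet₂ q≢q' j j≤count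
    in L₂' , run , related (trans quiet₁ (trans (centres r) (sym centre₂)))
                           λ p b′ → transfer-dominates k<j dominated-at-q t₁ t₂ p (counts r p b′)
    where
    t₁ : Transfer 1 (before s) (after s) (occ (tail L₁)) (occ (tail L₁'))
    t₁ = transfer-one q≢q' (moved s)
    dominated-before : Dominates (suc k) (suc (occ (tail L₁') (before s))) (occ (tail L₂) (before s))
    dominated-before =
      subst (λ x → Dominates (suc k) x (occ (tail L₂) (before s))) (sym (Transfer.source t₁)) (counts r _ b)
    quiet₁ : L₁' zero ≡ L₁ zero
    quiet₁ = hears-into-Qᵇ h centre-b
    quiet₂ : Hears a (L₂ zero) (L₂ zero)
    quiet₂ = subst (λ c → Hears a c c) (centres r) (subst (Hears a (L₁ zero)) quiet₁ h)

  simulate-≤ : StarStep n₁ L₁ L₁' → Related _≤_ (n₁ , L₁) (n₂ , L₂) → CatchesUp _≤_ (n₂ , L₂) (n₁ , L₁')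
  simulate-≤ (centre-τ tr frame)       r = catch-up-centre-τ tr frame r
  simulate-≤ (centre-bc m tr receives) r = catch-up-centre-bc z≤n m tr receives r
  simulate-≤ (leaf s) r with Qᵇ? (before s)
  ... | yes b   = catch-up-leaf-≤ s b r
  ... | no q∉ᵇ = _ , ε , silent-leaf s q∉ᵇ r

  simulate-dominates : Qᵇ (L₁' zero) → StarStep n₁ L₁ L₁' →
    Related (Dominates (suc k)) (n₁ , L₁) (n₂ , L₂) → CatchesUp (Dominates (suc k)) (n₂ , L₂) (n₁ , L₁')
  simulate-dominates _ (centre-τ tr frame) r = catch-up-centre-τ tr frame r
  simulate-dominates {k = k} _ (centre-bc m tr receives) r =
    catch-up-centre-bc (dominates-zero (suc k)) m tr receives r
  simulate-dominates centre-b (leaf s) r with Qᵇ? (before s) | before s Fin.≟ after s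
  ... | no q∉ᵇ | _         = _ , ε , silent-leaf s q∉ᵇ r
  ... | yes _  | yes stays = _ , ε , stationary-leaf s centre-b stays r
  ... | yes b  | no q≢q'   = catch-up-leaf-dominates s centre-b b q≢q' r

  centre-Qᵇ-backward : ∀ {n L L'} → StarRun n L L' → Qᵇ (L' zero) → Qᵇ (L zero)
  centre-Qᵇ-backward ε b = b
  centre-Qᵇ-backward (s ◅ run) b = step-backward s (centre-Qᵇ-backward run b)
    where
    step-backward : ∀ {n L L'} → StarStep n L L' → Qᵇ (L' zero) → Qᵇ (L zero)
    step-backward (centre-τ tr _)    = Qᵇ-backward tr
    step-backward (centre-bc _ tr _) = Qᵇ-backward tr
    step-backward (leaf s) b         = subst Qᵇ (hears-into-Qᵇ (LeafMove.heard s) b) b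

  simulate-run : StarRun n₁ L₁ L₁' → Qᵇ (L₁' zero) →
    Related (Dominates (suc k)) (n₁ , L₁) (n₂ , L₂) → CatchesUp (Dominates (suc k)) (n₂ , L₂) (n₁ , L₁')
  simulate-run ε _ r = _ , ε , r
  simulate-run (s ◅ run) b r with simulate-dominates (centre-Qᵇ-backward run b) s r
  ... | L₂' , run₂ , r' with simulate-run run b r'
  ...   | L₂'' , run₂' , r'' = L₂'' , run₂ ◅◅ run₂' , r''

  count≡leafCount : ∀ C q → count P C q ≡ leafCount C q
  count≡leafCount (n , L) q = occ-filter (tail L) id q

  preceq⇒related : ∀ {C₁ C₂} → Preceq P part C₁ C₂ → Related _≤_ C₁ C₂
  preceq⇒related {C₁} {C₂} (centres′ , le) =
    related centres′ λ q b → subst₂ _≤_ (count≡leafCount C₁ q) (count≡leafCount C₂ q) (le q b)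

  related⇒preceq : ∀ {C₁ C₂} → Related _≤_ C₁ C₂ → Preceq P part C₁ C₂
  related⇒preceq {C₁} {C₂} r =
    centres r , λ q b → subst₂ _≤_ (sym (count≡leafCount C₁ q)) (sym (count≡leafCount C₂ q)) (counts r q b)

  support : StarConf P → Q → Bool
  support C q = isB (part q) ∧ (0 <ᵇ leafCount C q)

  bprint≡support : ∀ C → bprint P part C ≡ (centre P C , tabulate (support C))
  bprint≡support (n , L) = cong (L zero ,_) (tabulate-cong λ q → cong (isB (part q) ∧_) (occ-any (tail L) id q))

  bprint⇒related : ∀ {C₁ C₂} → bprint P part C₁ ≡ bprint P part C₂ → Related SamePositivity C₁ C₂
  bprint⇒related {C₁} {C₂} e = related (cong proj₁ e) λ q b → subst (λ t → t ∧ _ ≡ t ∧ _) b (supports q)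
    where
    open ≡-Reasoning
    prints : (centre P C₁ , tabulate (support C₁)) ≡ (centre P C₂ , tabulate (support C₂))
    prints = trans (sym (bprint≡support C₁)) (trans e (bprint≡support C₂))
    supports : ∀ q → support C₁ q ≡ support C₂ q
    supports q = begin
      support C₁ q                      ≡⟨ lookup∘tabulate (support C₁) q ⟨
      lookup (tabulate (support C₁)) q  ≡⟨ cong (λ B → lookup (proj₂ B) q) prints ⟩
      lookup (tabulate (support C₂)) q  ≡⟨ lookup∘tabulate (support C₂) q ⟩
      support C₂ q                      ∎

  related⇒bprint : ∀ {C₁ C₂} → Related SamePositivity C₁ C₂ → bprint P part C₁ ≡ bprint P part C₂
  related⇒bprint {C₁} {C₂} r = begin
    bprint P part C₁                        ≡⟨ bprint≡support C₁ ⟩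
    (centre P C₁ , tabulate (support C₁))   ≡⟨ cong₂ _,_ (centres r) (tabulate-cong supports) ⟩
    (centre P C₂ , tabulate (support C₂))   ≡⟨ bprint≡support C₂ ⟨
    bprint P part C₂                        ∎
    where
    open ≡-Reasoning
    supports : ∀ q → support C₁ q ≡ support C₂ q
    supports q with isB (part q) in b
    ... | true  = counts r q b
    ... | false = refl

  ∈-bprint : ∀ C q → q ∈ proj₂ (bprint P part C) → Qᵇ q × (0 <ᵇ leafCount C q) ≡ true
  ∈-bprint C q q∈ = ∧-conicalˡ _ _ supported , ∧-conicalʳ _ _ supported
    where
    supported : support C q ≡ true
    supported = trans (sym (lookup∘tabulate (support C) q))
                      ([]=⇒lookup (subst (λ B → q ∈ proj₂ B) (bprint≡support C) q∈))

  topology-preserved : ∀ {C C'} → Reach P C C' → proj₁ C ≡ proj₁ C'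
  topology-preserved ε = refl
  topology-preserved (step _ _ _ _ _ _ _ _ ◅ run) = topology-preserved run

  initial-dominated : ∀ N {n L} → (∀ v → L v ≡ qin P) →
    Related (Dominates (suc N)) (n , L) (suc N * n , const (qin P))
  initial-dominated N {n} initial = related (initial zero) λ q _ →
    subst₂ (Dominates (suc N))
      (sym (trans (occ-≗ (initial ∘ suc)) (occ-const n (qin P) q)))
      (sym (trans (occ-const (suc N * n) (qin P) q) (*-assoc (suc N) n _)))
      (dominates-scale N (n * δ (qin P) q))

  dominated-counts-large : ∀ {C C'} → Related (Dominates (suc k)) C C' →
    ∀ q → q ∈ proj₂ (bprint P part C') → k ≤ count P C' q
  dominated-counts-large {C' = C'} r q q∈ =
    let b , positive = ∈-bprint C' q q∈
    in subst (_ ≤_) (sym (count≡leafCount C' q)) (<⇒≤ (dominates-≥ (counts r q b) positive))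

  simulation : (C₁ C₁' C₂ : StarConf P) →
    Step P (toConf P C₁) (toConf P C₁') → Preceq P part C₁ C₂ →
    ∃ λ (C₂' : StarConf P) → Preceq P part C₁' C₂' × Reach P (toConf P C₂) (toConf P C₂')
  -- Matching the step identifies the star topologies of C₁ and C₁'.
  simulation (_ , _) (_ , _) (n₂ , _) s@(step _ _ _ _ _ _ _ _) pre
    with simulate-≤ (starStep s) (preceq⇒related pre)
  ... | L₂' , run , r = (n₂ , L₂') , related⇒preceq r , fromStarRun run

  b-simulation : (C₁ C₁' C₂ : StarConf P) → IsBConf P part C₁ → IsBConf P part C₁' → IsBConf P part C₂ →
    Step P (toConf P C₁) (toConf P C₁') → bprint P part C₁ ≡ bprint P part C₂ → Preceq P part C₁ C₂ →
    ∃ λ (C₂' : StarConf P) → IsBConf P part C₂' × Preceq P part C₁' C₂'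
      × bprint P part C₁' ≡ bprint P part C₂' × Reach P (toConf P C₂) (toConf P C₂')
  b-simulation (_ , _) (_ , _) (n₂ , _) _ b₁' _ s@(step _ _ _ _ _ _ _ _) same pre
    with simulate-dominates {k = 0} b₁' (starStep s)
           (Related-zipWith ≤⇒dominates₁ (preceq⇒related pre) (bprint⇒related same))
  ... | L₂' , run , r =
    (n₂ , L₂') , subst Qᵇ (centres r) b₁' , related⇒preceq (Related-map dominates⇒≤ r) ,
    related⇒bprint (Related-map Dominates.samePositive r) , fromStarRun run

  amplification : (C : StarConf P) → IsBConf P part C →
    (∃ λ (Cin : Config P) → Initial P Cin × Reach P Cin (toConf P C)) →
    (N : ℕ) → ∃ λ (Cin' : Config P) → ∃ λ (C' : StarConf P) →
      Initial P Cin' × IsBConf P part C' × Reach P Cin' (toConf P C')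
      × bprint P part C ≡ bprint P part C'
      × ((q' : Fin (nQ P)) → q' ∈ proj₂ (bprint P part C') → N ≤ count P C' q')
  amplification (n , _) b ((_ , _) , initial , run) N with topology-preserved run
  ... | refl with simulate-run (starRun run) b (initial-dominated N initial)
  ...   | L₂' , run₂ , r =
    (star (suc N * n) , const (qin P)) , (suc N * n , L₂') , (λ _ → refl) , subst Qᵇ (centres r) b ,
    fromStarRun run₂ , related⇒bprint (Related-map Dominates.samePositive r) , dominated-counts-large r

mainTheorem10 : (P : Protocol) (part : Fin (nQ P) → Part) → PhaseBounded1 P part →
    ((C₁ C₁' C₂ : StarConf P) →
      Step P (toConf P C₁) (toConf P C₁') → Preceq P part C₁ C₂ →
      ∃ λ (C₂' : StarConf P) → Preceq P part C₁' C₂' × Reach P (toConf P C₂) (toConf P C₂'))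
    × ((C₁ C₁' C₂ : StarConf P) → IsBConf P part C₁ → IsBConf P part C₁' → IsBConf P part C₂ →
      Step P (toConf P C₁) (toConf P C₁') → bprint P part C₁ ≡ bprint P part C₂ →
      Preceq P part C₁ C₂ →
      ∃ λ (C₂' : StarConf P) → IsBConf P part C₂' × Preceq P part C₁' C₂'
        × bprint P part C₁' ≡ bprint P part C₂' × Reach P (toConf P C₂) (toConf P C₂'))
    × ((C : StarConf P) → IsBConf P part C →
      (∃ λ (Cin : Config P) → Initial P Cin × Reach P Cin (toConf P C)) →
      (N : ℕ) → ∃ λ (Cin' : Config P) → ∃ λ (C' : StarConf P) →
        Initial P Cin' × IsBConf P part C' × Reach P Cin' (toConf P C')
        × bprint P part C ≡ bprint P part C'
        × ((q' : Fin (nQ P)) → q' ∈ proj₂ (bprint P part C') → N ≤ count P C' q'))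
mainTheorem10 P part pb = simulation , b-simulation , amplification
  where open OnePhaseBounded P part pb
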